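{- Let $n\ge 3$ be an integer. Then $l_0^{(n-1)^3}(n^3)=11$ if $n=3$, and $l_0^{(n-1)^3}(n^3)=(n-1)^3+2$ if $n\ge 4$.
   Context: For a positive integer $d$ and integer $m$, define $$u_0^d(m)=\binom{m-\lfloor \frac{d}{2}\rfloor -1}{\lfloor \frac{d-1}{2}\rfloor}+\binom{m-\lfloor \frac{d-1}{2}\rfloor -1}{\lfloor \frac{d}{2}\rfloor},$$ and for a positive integer $x$ define $l_0^d(x)=k$ if and only if $k$ is the integer with $u_0^d(k-1)<x\leq u_0^d(k)$. -}

module Defs where

open import Data.Nat as ℕ using (ℕ; _∸_; _/_; _<_; _≤_)
open import Data.Nat.Combinatorics using (_C_)
open import Data.Integer as ℤ using (ℤ; +_; -[1+_])

-- Binomial coefficient with integer top entry and natural bottom entry,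
-- with the combinatorial convention  binom a k = 0  whenever a < k
-- (in particular for negative a).
binomℤ : ℤ → ℕ → ℕ
binomℤ (+ a)    k = a C k
binomℤ -[1+ _ ] k = 0

u0 : ℕ → ℤ → ℕ
u0 d m = binomℤ (m ℤ.- + (d / 2) ℤ.- + 1) ((d ∸ 1) / 2)
       ℕ.+ binomℤ (m ℤ.- + ((d ∸ 1) / 2) ℤ.- + 1) (d / 2)

L0 : ℕ → ℕ → ℤ → Set
L0 d x k = (u0 d (k ℤ.- + 1) < x) Data.Product.× (x ≤ u0 d k)
  where import Data.Product

-- For d ≥ 1 put a = ⌊d/2⌋ and b = ⌊(d-1)/2⌋, so that a + b + 1 = d and
-- u₀ᵈ(d + j) = C(j + b, b) + C(j + a, a).  Hence u₀ᵈ(d + 1) = d + 1, while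
-- 4 u₀ᵈ(d + 2) = 2((a+2)(a+1) + (b+2)(b+1)) ≥ (a + b + 2)² = (d + 1)², so
-- l₀ᵈ(x) = d + 2 whenever d + 1 < x and 4x ≤ (d + 1)².  For d = (n-1)³ and
-- x = n³ both conditions hold once n ≥ 4; for n = 3 the value 11 is computed.
module Submission where

open import Defs
open import Data.Nat using (ℕ; _≥_; _∸_; _^_; _+_)
open import Data.Integer using (+_)
open import Data.Product using (_×_)
open import Relation.Binary.PropositionalEquality using (_≡_)

open import Data.Nat using (zero; suc; _*_; _≤_; _<_; _<?_; _≤?_; s≤s; z≤n; NonZero; ⌊_/2⌋; ⌈_/2⌉)
open import Data.Nat.Properties
open import Data.Nat.DivMod using (_/_; m/n≡1+[m∸n]/n)
open import Data.Nat.Combinatorics using (_C_; nCk≡nC[n∸k]; nC1≡n; nCk+nC[k+1]≡[n+1]C[k+1])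
import Data.Integer as ℤ
import Data.Integer.Tactic.RingSolver as ℤ-Solver
open import Data.Nat.Tactic.RingSolver using (solve-∀)
open import Data.Product using (_,_)
open import Data.Sum using ([_,_]′)
open import Data.Unit using (tt)
open import Relation.Binary.PropositionalEquality using (refl; sym; trans; cong; cong₂; subst; subst₂; module ≡-Reasoning)
open import Relation.Nullary.Decidable using (toWitness)

n/2≡⌊n/2⌋ : ∀ n → n / 2 ≡ ⌊ n /2⌋
n/2≡⌊n/2⌋ zero          = refl
n/2≡⌊n/2⌋ (suc zero)    = refl
n/2≡⌊n/2⌋ (suc (suc n)) = trans (m/n≡1+[m∸n]/n {suc (suc n)} {2} (s≤s (s≤s z≤n))) (cong suc (n/2≡⌊n/2⌋ n))

[1+⌊n/2⌋]+[1+⌈n/2⌉]≡1+n+1 : ∀ n → (1 + ⌊ n /2⌋) + (1 + ⌈ n /2⌉) ≡ suc n + 1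
[1+⌊n/2⌋]+[1+⌈n/2⌉]≡1+n+1 n =
  trans (cong suc (trans (+-suc ⌊ n /2⌋ ⌈ n /2⌉) (cong suc (⌊n/2⌋+⌈n/2⌉≡n n)))) (+-comm 1 (suc n))

[1+n]Cn≡1+n : ∀ n → suc n C n ≡ suc n
[1+n]Cn≡1+n n = begin
  suc n C n           ≡⟨ nCk≡nC[n∸k] (n≤1+n n) ⟩
  suc n C (1 + n ∸ n) ≡⟨ cong (suc n C_) (m+n∸n≡m 1 n) ⟩
  suc n C 1           ≡⟨ nC1≡n (suc n) ⟩
  suc n               ∎
  where open ≡-Reasoning

2*[1+n]C2≡[1+n]*n : ∀ n → 2 * (suc n C 2) ≡ suc n * n
2*[1+n]C2≡[1+n]*n zero    = refl
2*[1+n]C2≡[1+n]*n (suc n) = begin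
  2 * (suc (suc n) C 2)         ≡⟨ cong (2 *_) (sym (nCk+nC[k+1]≡[n+1]C[k+1] (suc n) 1)) ⟩
  2 * (suc n C 1 + suc n C 2)   ≡⟨ cong (λ c → 2 * (c + suc n C 2)) (nC1≡n (suc n)) ⟩
  2 * (suc n + suc n C 2)       ≡⟨ *-distribˡ-+ 2 (suc n) (suc n C 2) ⟩
  2 * suc n + 2 * (suc n C 2)   ≡⟨ cong (_+_ (2 * suc n)) (2*[1+n]C2≡[1+n]*n n) ⟩
  2 * suc n + suc n * n         ≡⟨ expand n ⟩
  (2 + n) * suc n               ∎
  where
  open ≡-Reasoning
  expand : ∀ n → 2 * suc n + suc n * n ≡ (2 + n) * suc n
  expand = solve-∀

2*[2+n]Cn≡[2+n]*[1+n] : ∀ n → 2 * ((2 + n) C n) ≡ (2 + n) * (1 + n)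
2*[2+n]Cn≡[2+n]*[1+n] n = begin
  2 * ((2 + n) C n)           ≡⟨ cong (2 *_) (nCk≡nC[n∸k] (m≤n+m n 2)) ⟩
  2 * ((2 + n) C (2 + n ∸ n)) ≡⟨ cong (λ k → 2 * ((2 + n) C k)) (m+n∸n≡m 2 n) ⟩
  2 * ((2 + n) C 2)           ≡⟨ 2*[1+n]C2≡[1+n]*n (suc n) ⟩
  (2 + n) * (1 + n)           ∎
  where open ≡-Reasoning

[x+y]²≤2*[x²+y²] : ∀ x y → (x + y) * (x + y) ≤ 2 * (x * x + y * y)
[x+y]²≤2*[x²+y²] x y = [ ordered , swapped ]′ (≤-total x y)
  where
  ordered : ∀ {x y} → x ≤ y → (x + y) * (x + y) ≤ 2 * (x * x + y * y)
  ordered {x} {y} x≤y = subst (λ y → (x + y) * (x + y) ≤ 2 * (x * x + y * y)) (m+[n∸m]≡n x≤y) (offset x (y ∸ x))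
    where
    offset : ∀ x k → (x + (x + k)) * (x + (x + k)) ≤ 2 * (x * x + (x + k) * (x + k))
    offset x k = ≤-trans (m≤m+n _ (k * k)) (≤-reflexive (sym (gap x k)))
      where
      gap : ∀ x k → 2 * (x * x + (x + k) * (x + k)) ≡ (x + (x + k)) * (x + (x + k)) + k * k
      gap = solve-∀

  swapped : y ≤ x → (x + y) * (x + y) ≤ 2 * (x * x + y * y)
  swapped y≤x = subst₂ _≤_ (cong (λ s → s * s) (+-comm y x)) (cong (2 *_) (+-comm (y * y) (x * x))) (ordered y≤x)

[1+n]³+1<[2+n]³ : ∀ n → suc n ^ 3 + 1 < (2 + n) ^ 3
[1+n]³+1<[2+n]³ n = ≤-trans (m≤m+n _ _) (≤-reflexive (sym (expand n)))
  where
  -- k ^ 3 unfolds to k * (k * (k * 1)); the ring solver does not interpret _^_.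
  expand : ∀ n → (2 + n) * ((2 + n) * ((2 + n) * 1)) ≡ 1 + ((1 + n) * ((1 + n) * ((1 + n) * 1)) + 1) + (3 * n * n + 9 * n + 5)
  expand = solve-∀

4*[4+n]³≤[[3+n]³+1]² : ∀ n → 4 * (4 + n) ^ 3 ≤ ((3 + n) ^ 3 + 1) * ((3 + n) ^ 3 + 1)
4*[4+n]³≤[[3+n]³+1]² n = ≤-trans (m≤m+n _ _) (≤-reflexive (sym (expand n)))
  where
  expand : ∀ n → let c = (3 + n) * ((3 + n) * ((3 + n) * 1)) in (c + 1) * (c + 1)
               ≡ 4 * ((4 + n) * ((4 + n) * ((4 + n) * 1)))
                 + (528 + 1320 * n + 1185 * n * n + 538 * n * n * n + 135 * n * n * n * n + 18 * n * n * n * n * n + n * n * n * n * n * n)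
  expand = solve-∀

+[1+c+j]-a-1≡+[j+b] : ∀ {a b c} j → a + b ≡ c → + (suc c + j) ℤ.- + a ℤ.- + 1 ≡ + (j + b)
+[1+c+j]-a-1≡+[j+b] {a} {b} j refl = cancel (+ a) (+ b) (+ j)
  where
  -- + (suc (a + b) + j) and + 1 ℤ.+ (+ a ℤ.+ + b ℤ.+ + j) are definitionally equal.
  cancel : ∀ x y z → + 1 ℤ.+ (x ℤ.+ y ℤ.+ z) ℤ.- x ℤ.- + 1 ≡ z ℤ.+ y
  cancel = ℤ-Solver.solve-∀

u0-at-d+j : ∀ e j → u0 (suc e) (+ (suc e + j)) ≡ (j + ⌊ e /2⌋) C ⌊ e /2⌋ + (j + ⌈ e /2⌉) C ⌈ e /2⌉
u0-at-d+j e j = cong₂ _+_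
  (cong₂ binomℤ (top (n/2≡⌊n/2⌋ (suc e)) (trans (+-comm ⌈ e /2⌉ ⌊ e /2⌋) (⌊n/2⌋+⌈n/2⌉≡n e))) (n/2≡⌊n/2⌋ e))
  (cong₂ binomℤ (top (n/2≡⌊n/2⌋ e) (⌊n/2⌋+⌈n/2⌉≡n e)) (n/2≡⌊n/2⌋ (suc e)))
  where
  top : ∀ {h a b} → h ≡ a → a + b ≡ e → + (suc e + j) ℤ.- + h ℤ.- + 1 ≡ + (j + b)
  top refl = +[1+c+j]-a-1≡+[j+b] j

u0-at-d+1 : ∀ e → u0 (suc e) (+ (suc e + 1)) ≡ suc e + 1
u0-at-d+1 e = begin
  u0 (suc e) (+ (suc e + 1))                        ≡⟨ u0-at-d+j e 1 ⟩
  suc ⌊ e /2⌋ C ⌊ e /2⌋ + suc ⌈ e /2⌉ C ⌈ e /2⌉     ≡⟨ cong₂ _+_ ([1+n]Cn≡1+n ⌊ e /2⌋) ([1+n]Cn≡1+n ⌈ e /2⌉) ⟩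
  suc ⌊ e /2⌋ + suc ⌈ e /2⌉                         ≡⟨ [1+⌊n/2⌋]+[1+⌈n/2⌉]≡1+n+1 e ⟩
  suc e + 1                                         ∎
  where open ≡-Reasoning

[d+1]²≤4*u0-at-d+2 : ∀ e → (suc e + 1) * (suc e + 1) ≤ 4 * u0 (suc e) (+ (suc e + 2))
[d+1]²≤4*u0-at-d+2 e = begin
  (suc e + 1) * (suc e + 1)                     ≡⟨ cong (λ s → s * s) (sym ([1+⌊n/2⌋]+[1+⌈n/2⌉]≡1+n+1 e)) ⟩
  (suc b + suc a) * (suc b + suc a)             ≤⟨ [x+y]²≤2*[x²+y²] (suc b) (suc a) ⟩
  2 * (suc b * suc b + suc a * suc a)           ≤⟨ *-monoʳ-≤ 2 (+-mono-≤ (square≤ b) (square≤ a)) ⟩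
  2 * ((2 + b) * suc b + (2 + a) * suc a)       ≡⟨ cong (2 *_) (sym (cong₂ _+_ (2*[2+n]Cn≡[2+n]*[1+n] b) (2*[2+n]Cn≡[2+n]*[1+n] a))) ⟩
  2 * (2 * ((2 + b) C b) + 2 * ((2 + a) C a))   ≡⟨ cong (2 *_) (sym (*-distribˡ-+ 2 ((2 + b) C b) ((2 + a) C a))) ⟩
  2 * (2 * ((2 + b) C b + (2 + a) C a))         ≡⟨ sym (*-assoc 2 2 ((2 + b) C b + (2 + a) C a)) ⟩
  4 * ((2 + b) C b + (2 + a) C a)               ≡⟨ cong (4 *_) (sym (u0-at-d+j e 2)) ⟩
  4 * u0 (suc e) (+ (suc e + 2))                ∎
  where
  open ≤-Reasoning
  a = ⌈ e /2⌉
  b = ⌊ e /2⌋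
  square≤ : ∀ n → suc n * suc n ≤ (2 + n) * suc n
  square≤ n = *-monoˡ-≤ (suc n) (n≤1+n (suc n))

l0-at-d+2 : ∀ d x .{{_ : NonZero d}} → d + 1 < x → 4 * x ≤ (d + 1) * (d + 1) → L0 d x (+ (d + 2))
l0-at-d+2 (suc e) x d+1<x 4x≤[d+1]² = u0-below , u0-above
  where
  pred≡d+1 : + (suc e + 2) ℤ.- + 1 ≡ + (suc e + 1)
  pred≡d+1 = cong (λ k → + k ℤ.- + 1) (+-suc (suc e) 1)

  u0-below : u0 (suc e) (+ (suc e + 2) ℤ.- + 1) < x
  u0-below = subst (_< x) (sym (trans (cong (u0 (suc e)) pred≡d+1) (u0-at-d+1 e))) d+1<x

  u0-above : x ≤ u0 (suc e) (+ (suc e + 2))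
  u0-above = *-cancelˡ-≤ 4 (≤-trans 4x≤[d+1]² ([d+1]²≤4*u0-at-d+2 e))

l0-8-27 : L0 8 27 (+ 11)
l0-8-27 = toWitness {a? = u0 8 (+ 10) <? 27} tt , toWitness {a? = 27 ≤? u0 8 (+ 11)} tt

corollary7 : (n : ℕ) → n ≥ 3 →
    (n ≡ 3 → L0 ((n ∸ 1) ^ 3) (n ^ 3) (+ 11)) ×
    (n ≥ 4 → L0 ((n ∸ 1) ^ 3) (n ^ 3) (+ ((n ∸ 1) ^ 3 + 2)))
corollary7 (suc zero)        (s≤s ())
corollary7 (suc (suc zero))  (s≤s (s≤s ()))
corollary7 3                 _ = (λ _ → l0-8-27) , λ { (s≤s (s≤s (s≤s ()))) }
corollary7 (suc (suc (suc (suc m)))) _ =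
  (λ ()) , λ _ → l0-at-d+2 ((3 + m) ^ 3) ((4 + m) ^ 3) ([1+n]³+1<[2+n]³ (2 + m)) (4*[4+n]³≤[[3+n]³+1]² m)
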